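{- Let $G$ be an ortho-chain $k$-gon cactus with $h\ge 2$ $k$-gons. Then $W_p(G)=5h-6$ if $k=3$; $W_p(G)=7h-8$ if $k=4$; $W_p(G)=9h-10$ if $k=5$; $W_p(G)=12h-10$ if $k=6$; and $W_p(G)=(k+9)h-10$ if $k\ge 7$.
   Context: All graphs are finite, simple and undirected. The Wiener polarity index $W_p(G)$ of a connected graph $G$ is the number of unordered pairs of vertices $\{u,v\}$ with distance $d_G(u,v)=3$. A cactus graph is a connected graph in which no edge lies in more than one cycle. A $k$-gon cactus is a cactus graph in which every block is a cycle of length $k$. A chain $k$-gon cactus is a $k$-gon cactus in which each $k$-gon has at most two cut-vertices and each cut-vertex is shared by exactly two $k$-gons; it is of type 1 if any two cut-vertices lying on a common $k$-gon are at distance $1$, and of type 2 if any two such cut-vertices are at distance at least $2$. An ortho-chain $k$-gon cactus with $h$ $k$-gons is obtained from a chain $k$-gon cactus of type 1 with $h$ $k$-gons by expanding each cut-vertex to an edge: a cut-vertex $c$ shared by $k$-gons $A$ and $B$ is replaced by two new adjacent vertices $c_A,c_B$, where $c_A$ takes the place of $c$ in $A$ and $c_B$ takes the place of $c$ in $B$ (so the $k$-gons become vertex-disjoint $k$-cycles joined by bridges). -}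

module Defs where

open import Data.Bool using (Bool; true; false; _∧_; _∨_; not; if_then_else_)
open import Data.Nat using (ℕ; zero; suc; _+_; _*_; _∸_; _≡ᵇ_; _<ᵇ_)
open import Data.Fin using (Fin; toℕ; remQuot)
open import Data.Product using (_×_; _,_)
open import Data.List using (List; []; _∷_; length; filter; allFin; concatMap; map)
open import Data.Bool.ListAction using (any)
open import Relation.Nullary.Decidable using (Dec; yes; no)
open import Relation.Binary.PropositionalEquality using (_≡_)
open import Data.Bool.Properties using (T?)
open import Data.Bool using (T)

-- A finite simple graph on the vertex set Fin n, given by a Boolean
-- adjacency function (assumed symmetric and irreflexive where used).

Graph : ℕ → Set
Graph n = Fin n → Fin n → Bool

reach : ∀ {n} → Graph n → ℕ → Fin n → Fin n → Bool
reach G zero    u v = toℕ u ≡ᵇ toℕ v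
reach G (suc m) u v = reach G m u v ∨ any (λ w → G u w ∧ reach G m w v) (allFin _)

dist3 : ∀ {n} → Graph n → Fin n → Fin n → Bool
dist3 G u v = reach G 3 u v ∧ not (reach G 2 u v)

unorderedPairs : ∀ n → List (Fin n × Fin n)
unorderedPairs n =
  concatMap (λ u → map (λ v → (u , v)) (filter (λ v → T? (toℕ u <ᵇ toℕ v)) (allFin n))) (allFin n)

Wp : ∀ {n} → Graph n → ℕ
Wp {n} G = length (filter (λ p → T? (pair p)) (unorderedPairs n))
  where
  pair : Fin n × Fin n → Bool
  pair (u , v) = dist3 G u v

-- Vertex (i , j) with i : Fin h (which k-gon) and j : Fin k (position on
-- the k-cycle), encoded in Fin (h * k) via remQuot.
-- Edges: (i , j) ~ (i , j+1 mod k)  (the k-cycles), and the bridges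
-- (i , 1) ~ (i+1 , 0) for consecutive k-gons.  (Gon i is entered at
-- vertex 0 and left at vertex 1; these two are adjacent, as in the
-- type-1 chain from which the ortho-chain is obtained.)

cycleAdj : (k : ℕ) → ℕ → ℕ → Bool
cycleAdj k a b = (suc a ≡ᵇ b) ∨ (suc b ≡ᵇ a)
               ∨ ((a ≡ᵇ 0) ∧ (suc b ≡ᵇ k))
               ∨ ((b ≡ᵇ 0) ∧ (suc a ≡ᵇ k))

bridgeAdj : ℕ → ℕ → ℕ → ℕ → Bool
bridgeAdj i a i' b = ((suc i ≡ᵇ i') ∧ (a ≡ᵇ 1) ∧ (b ≡ᵇ 0))
                   ∨ ((suc i' ≡ᵇ i) ∧ (b ≡ᵇ 1) ∧ (a ≡ᵇ 0))

orthoChainAdj : (h k : ℕ) → ℕ → ℕ → ℕ → ℕ → Bool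
orthoChainAdj h k i a i' b =
  ((i ≡ᵇ i') ∧ cycleAdj k a b) ∨ bridgeAdj i a i' b

orthoChain : (h k : ℕ) → Graph (h * k)
orthoChain h k x y with remQuot {h} k x | remQuot {h} k y
... | (i , a) | (i' , b) = orthoChainAdj h k (toℕ i) (toℕ a) (toℕ i') (toℕ b)

module Submission where

-- Label the vertex (i , a) of the ortho-chain by its gon i and its position a on the k-cycle of
-- that gon, which is entered at position 0 and left at position 1.  Distances are then explicit:
-- inside a gon they are cycle distances min(d, k - d), and a shortest path from (i , a) to a later
-- gon runs to the exit 1, crosses the bridge to (i + 1 , 0) and continues from there.  This function
-- (chainDist) is the graph distance because it vanishes only on the diagonal, changes by at most one
-- along every edge, and decreases by one along some edge at every other vertex.  It only depends on
-- the difference of the gon indices, so removing the first gon shows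
--   W_p = h W_p(C_k) + (h - 1) X + (h - 2) Y,
-- where X counts the pairs at distance 3 in consecutive gons, those with d(a, 1) + d(0, b) = 2,
-- Y = 1 counts the single pair (exit, entrance) of gons two apart, and gons further apart are at
-- distance at least 5.  For k >= 5, X = 1*2 + 2*2 + 2*1 = 8 since a k-cycle has one vertex at
-- distance 0 and two at distances 1 and 2 from a given vertex, and for k >= 7 every vertex of C_k
-- has exactly two vertices at distance 3, so W_p(C_k) = k.

open import Defs
import Algebra.Properties.Semiring.Sum
open import Data.Bool using (Bool; true; false; T; _∧_; _∨_; not)
open import Data.Bool.Properties using (T?; T-∨; T-∧)
open import Data.Empty using (⊥-elim)
open import Data.Fin as Fin using (Fin; toℕ; fromℕ; fromℕ<; inject₁; _↑ˡ_; _↑ʳ_; combine; remQuot)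
open import Data.Fin.Properties
  using (toℕ-injective; toℕ-inject₁; toℕ-fromℕ; toℕ<n; toℕ-fromℕ<; combine-remQuot; remQuot-combine;
         toℕ-combine)
open import Data.List as List using (List; []; _∷_; length; filter; map; concatMap; tabulate; allFin)
import Data.List.Properties as List
open import Data.List.Membership.Propositional using (lose)
open import Data.List.Membership.Propositional.Properties using (∈-allFin)
open import Data.List.Relation.Unary.Any using (satisfied)
open import Data.List.Relation.Unary.Any.Properties using (any⁺; any⁻)
open import Data.Nat
open import Data.Nat.ListAction using () renaming (sum to listSum)
open import Data.Nat.ListAction.Properties using () renaming (sum-++ to listSum-++)
open import Data.Nat.Properties
open import Data.Nat.Tactic.RingSolver using (solve-∀)
open import Data.Product using (∃-syntax; _×_; _,_; proj₁; proj₂; uncurry)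
open import Data.Sum using (_⊎_; inj₁; inj₂)
open import Function using (_∘_; id; Equivalence)
open import Relation.Binary.Definitions using (tri<; tri≈; tri>)
open import Relation.Binary.PropositionalEquality
open import Relation.Nullary.Decidable using (yes; no; dec-true; dec-false)
open import Relation.Nullary.Negation using (contradiction)

open Algebra.Properties.Semiring.Sum +-*-semiring

-- Finite sums

𝟙 : Bool → ℕ
𝟙 true  = 1
𝟙 false = 0

≡⇒𝟙≡1 : ∀ {m n} → m ≡ n → 𝟙 (m ≡ᵇ n) ≡ 1
≡⇒𝟙≡1 {m} {n} m≡n = cong 𝟙 (dec-true (m ≟ n) m≡n)

≢⇒𝟙≡0 : ∀ {m n} → m ≢ n → 𝟙 (m ≡ᵇ n) ≡ 0
≢⇒𝟙≡0 {m} {n} m≢n = cong 𝟙 (dec-false (m ≟ n) m≢n)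

∑-zero : ∀ n → ∑[ x < n ] 0 ≡ 0
∑-zero = sum-replicate-zero

∑-𝟙-≡ : ∀ n c → ∑[ x < n ] 𝟙 (toℕ x ≡ᵇ c) ≡ 𝟙 (c <ᵇ n)
∑-𝟙-≡ zero    c       = refl
∑-𝟙-≡ (suc n) zero    = cong suc (∑-zero n)
∑-𝟙-≡ (suc n) (suc c) = ∑-𝟙-≡ n c

∑-𝟙-+< : ∀ n c m → ∑[ x < n ] 𝟙 (c + toℕ x <ᵇ m) ≡ n ⊓ (m ∸ c)
∑-𝟙-+< zero    zero    m       = refl
∑-𝟙-+< (suc n) zero    zero    = ∑-zero n
∑-𝟙-+< (suc n) zero    (suc m) = cong suc (∑-𝟙-+< n 0 m)
∑-𝟙-+< n       (suc c) zero    = trans (∑-zero n) (sym (⊓-zeroʳ n))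
∑-𝟙-+< n       (suc c) (suc m) = ∑-𝟙-+< n c m

∑-𝟙-< : ∀ n c → ∑[ x < n ] 𝟙 (toℕ x + c <ᵇ n) ≡ n ∸ c
∑-𝟙-< n c = begin
  ∑[ x < n ] 𝟙 (toℕ x + c <ᵇ n) ≡⟨ sum-cong-≗ {n} (λ x → cong (𝟙 ∘ (_<ᵇ n)) (+-comm (toℕ x) c)) ⟩
  ∑[ x < n ] 𝟙 (c + toℕ x <ᵇ n) ≡⟨ ∑-𝟙-+< n c n ⟩
  n ⊓ (n ∸ c)                   ≡⟨ m≥n⇒m⊓n≡n (m∸n≤m n c) ⟩
  n ∸ c                         ∎
  where open ≡-Reasoning

∑-product : ∀ m n (f : Fin m → ℕ) (g : Fin n → ℕ) →
            ∑[ a < m ] ∑[ b < n ] (f a * g b) ≡ (∑[ a < m ] f a) * (∑[ b < n ] g b)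
∑-product m n f g = trans (sum-cong-≗ {m} (λ a → sym (*-distribˡ-sum (f a) g)))
                          (sym (*-distribʳ-sum (∑[ b < n ] g b) f))

∑²-distrib-+ : ∀ m n (F G : Fin m → Fin n → ℕ) →
               ∑[ a < m ] ∑[ b < n ] (F a b + G a b) ≡ ∑[ a < m ] ∑[ b < n ] F a b + ∑[ a < m ] ∑[ b < n ] G a b
∑²-distrib-+ m n F G = trans (sum-cong-≗ {m} (λ a → ∑-distrib-+ {n} (F a) (G a)))
                             (∑-distrib-+ {m} (λ a → ∑[ b < n ] F a b) (λ a → ∑[ b < n ] G a b))

∑-↑ : ∀ m n (f : Fin (m + n) → ℕ) →
      ∑[ x < m + n ] f x ≡ ∑[ i < m ] f (i ↑ˡ n) + ∑[ j < n ] f (m ↑ʳ j)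
∑-↑ zero    n f = refl
∑-↑ (suc m) n f = trans (cong (f Fin.zero +_) (∑-↑ m n (f ∘ Fin.suc)))
                        (sym (+-assoc (f Fin.zero) _ _))

∑-combine : ∀ m n (f : Fin (m * n) → ℕ) →
            ∑[ x < m * n ] f x ≡ ∑[ i < m ] ∑[ a < n ] f (combine i a)
∑-combine zero    n f = refl
∑-combine (suc m) n f = trans (∑-↑ n (m * n) f)
                              (cong (∑[ a < n ] f (a ↑ˡ m * n) +_) (∑-combine m n (f ∘ (n ↑ʳ_))))

module _ {A : Set} where

  length-filter-𝟙 : ∀ (p : A → Bool) xs → length (filter (T? ∘ p) xs) ≡ listSum (map (𝟙 ∘ p) xs)
  length-filter-𝟙 p []       = refl
  length-filter-𝟙 p (x ∷ xs) with p x
  ... | true  = cong suc (length-filter-𝟙 p xs)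
  ... | false = length-filter-𝟙 p xs

  listSum-filter : ∀ (p q : A → Bool) xs →
                   listSum (map (𝟙 ∘ p) (filter (T? ∘ q) xs)) ≡ listSum (map (λ x → 𝟙 (q x ∧ p x)) xs)
  listSum-filter p q []       = refl
  listSum-filter p q (x ∷ xs) with q x
  ... | true  = cong (𝟙 (p x) +_) (listSum-filter p q xs)
  ... | false = listSum-filter p q xs

  listSum-concatMap : ∀ {B : Set} (g : B → ℕ) (f : A → List B) xs →
                      listSum (map g (concatMap f xs)) ≡ listSum (map (λ x → listSum (map g (f x))) xs)
  listSum-concatMap g f []       = refl
  listSum-concatMap g f (x ∷ xs) = begin
    listSum (map g (f x List.++ concatMap f xs))               ≡⟨ cong listSum (List.map-++ g (f x) _) ⟩
    listSum (map g (f x) List.++ map g (concatMap f xs))       ≡⟨ listSum-++ (map g (f x)) _ ⟩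
    listSum (map g (f x)) + listSum (map g (concatMap f xs))
      ≡⟨ cong (listSum (map g (f x)) +_) (listSum-concatMap g f xs) ⟩
    listSum (map g (f x)) + listSum (map (λ y → listSum (map g (f y))) xs) ∎
    where open ≡-Reasoning

listSum-allFin : ∀ n (g : Fin n → ℕ) → listSum (map g (allFin n)) ≡ ∑[ x < n ] g x
listSum-allFin n g = trans (cong listSum (List.map-tabulate id g)) (tabulate-sum n g)
  where
  tabulate-sum : ∀ n (g : Fin n → ℕ) → listSum (tabulate g) ≡ ∑[ x < n ] g x
  tabulate-sum zero    g = refl
  tabulate-sum (suc n) g = cong (g Fin.zero +_) (tabulate-sum n (g ∘ Fin.suc))

Wp≡∑ : ∀ {n} (G : Graph n) → Wp G ≡ ∑[ u < n ] ∑[ v < n ] 𝟙 ((toℕ u <ᵇ toℕ v) ∧ dist3 G u v)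
Wp≡∑ {n} G = begin
  Wp G
    ≡⟨ length-filter-𝟙 pairDist3 (unorderedPairs n) ⟩
  listSum (map (𝟙 ∘ pairDist3) (unorderedPairs n))
    ≡⟨ listSum-concatMap (𝟙 ∘ pairDist3) row (allFin n) ⟩
  listSum (map (λ u → listSum (map (𝟙 ∘ pairDist3) (row u))) (allFin n))
    ≡⟨ cong listSum (List.map-cong (λ u → cong listSum (sym (List.map-∘ (laterThan u)))) (allFin n)) ⟩
  listSum (map (λ u → listSum (map (𝟙 ∘ dist3 G u) (laterThan u))) (allFin n))
    ≡⟨ cong listSum (List.map-cong (λ u → listSum-filter (dist3 G u) (later u) (allFin n)) (allFin n)) ⟩
  listSum (map (λ u → listSum (map (λ v → 𝟙 (later u v ∧ dist3 G u v)) (allFin n))) (allFin n))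
    ≡⟨ cong listSum (List.map-cong (λ u → listSum-allFin n _) (allFin n)) ⟩
  listSum (map (λ u → ∑[ v < n ] 𝟙 (later u v ∧ dist3 G u v)) (allFin n))
    ≡⟨ listSum-allFin n _ ⟩
  ∑[ u < n ] ∑[ v < n ] 𝟙 (later u v ∧ dist3 G u v) ∎
  where
  open ≡-Reasoning
  later : Fin n → Fin n → Bool
  later u v = toℕ u <ᵇ toℕ v
  laterThan : Fin n → List (Fin n)
  laterThan u = filter (T? ∘ later u) (allFin n)
  pairDist3 : Fin n × Fin n → Bool
  pairDist3 (u , v) = dist3 G u v
  row : Fin n → List (Fin n × Fin n)
  row u = map (u ,_) (laterThan u)

-- Graph distance from a distance function

∨-introˡ : ∀ {x y} → T x → T (x ∨ y)
∨-introˡ = Equivalence.from T-∨ ∘ inj₁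

∨-introʳ : ∀ {x y} → T y → T (x ∨ y)
∨-introʳ = Equivalence.from T-∨ ∘ inj₂

∧-intro : ∀ {x y} → T x → T y → T (x ∧ y)
∧-intro p q = Equivalence.from T-∧ (p , q)

≡ᵇ-refl : ∀ n → T (n ≡ᵇ n)
≡ᵇ-refl n = ≡⇒≡ᵇ n n refl

T-injective : ∀ {x y} → (T x → T y) → (T y → T x) → x ≡ y
T-injective {false} {false} _ _ = refl
T-injective {false} {true}  _ g = ⊥-elim (g _)
T-injective {true}  {false} f _ = ⊥-elim (f _)
T-injective {true}  {true}  _ _ = refl

≤3∧≰2≡≡3 : ∀ d → (d ≤ᵇ 3) ∧ not (d ≤ᵇ 2) ≡ (d ≡ᵇ 3)
≤3∧≰2≡≡3 0                         = refl
≤3∧≰2≡≡3 1                         = refl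
≤3∧≰2≡≡3 2                         = refl
≤3∧≰2≡≡3 3                         = refl
≤3∧≰2≡≡3 (suc (suc (suc (suc d)))) = refl

record IsDistanceTo {n} (G : Graph n) (v : Fin n) (D : Fin n → ℕ) : Set where
  field
    zero⇒target : ∀ u → D u ≡ 0 → u ≡ v
    target      : D v ≡ 0
    lipschitz   : ∀ u w → T (G u w) → D u ≤ suc (D w)
    descent     : ∀ u {m} → D u ≡ suc m → ∃[ w ] T (G u w) × D w ≡ m

  reach⇒≤ : ∀ m u → T (reach G m u v) → D u ≤ m
  reach⇒≤ zero    u r with refl ← toℕ-injective (≡ᵇ⇒≡ (toℕ u) (toℕ v) r) = ≤-reflexive target
  reach⇒≤ (suc m) u r with Equivalence.to T-∨ r
  ... | inj₁ r′ = m≤n⇒m≤1+n (reach⇒≤ m u r′)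
  ... | inj₂ r′ with w , uw∧r″ ← satisfied (any⁻ _ (allFin n) r′)
                 with uw , r″ ← Equivalence.to T-∧ uw∧r″ = ≤-trans (lipschitz u w uw) (s≤s (reach⇒≤ m w r″))

  ≤⇒reach : ∀ m u → D u ≤ m → T (reach G m u v)
  ≤⇒reach zero    u Du≤0 with refl ← zero⇒target u (n≤0⇒n≡0 Du≤0) = ≡ᵇ-refl (toℕ u)
  ≤⇒reach (suc m) u Du≤1+m with m≤n⇒m<n∨m≡n Du≤1+m
  ... | inj₁ Du≤m = ∨-introˡ (≤⇒reach m u (s≤s⁻¹ Du≤m))
  ... | inj₂ Du≡1+m with w , uw , Dw≡m ← descent u Du≡1+m =
    ∨-introʳ (any⁺ _ (lose (∈-allFin w) (∧-intro uw (≤⇒reach m w (≤-reflexive Dw≡m)))))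

  dist3≡ : ∀ u → dist3 G u v ≡ (D u ≡ᵇ 3)
  dist3≡ u = begin
    reach G 3 u v ∧ not (reach G 2 u v) ≡⟨ cong₂ (λ x y → x ∧ not y) (reach≡ 3) (reach≡ 2) ⟩
    (D u ≤ᵇ 3) ∧ not (D u ≤ᵇ 2)         ≡⟨ ≤3∧≰2≡≡3 (D u) ⟩
    (D u ≡ᵇ 3)                          ∎
    where
    open ≡-Reasoning
    reach≡ : ∀ m → reach G m u v ≡ (D u ≤ᵇ m)
    reach≡ m = T-injective (≤⇒≤ᵇ ∘ reach⇒≤ m u) (≤⇒reach m u ∘ ≤ᵇ⇒≤ (D u) m)

-- Distance on a cycle

Near : ℕ → ℕ → Set
Near m n = m ≤ suc n × n ≤ suc m

near-sym : ∀ {m n} → Near m n → Near n m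
near-sym (p , q) = q , p

near-suc : ∀ n → Near n (suc n)
near-suc n = ≤-trans (n≤1+n n) (n≤1+n (suc n)) , ≤-refl

near-+ʳ : ∀ {x y} c → Near x y → Near (x + c) (y + c)
near-+ʳ c (x≤1+y , y≤1+x) = +-monoˡ-≤ c x≤1+y , +-monoˡ-≤ c y≤1+x

wrapDist : ℕ → ℕ → ℕ
wrapDist k d = d ⊓ (k ∸ d)

cycleDist : ℕ → ℕ → ℕ → ℕ
cycleDist k a b = wrapDist k ∣ a - b ∣

wrapDist-near : ∀ k d → Near (wrapDist k d) (wrapDist k (suc d))
wrapDist-near k d =
  ⊓-mono-≤ (≤-trans (n≤1+n d) (n≤1+n (suc d))) (k∸d≤1+k∸[1+d] k d) ,
  ⊓-mono-≤ ≤-refl (≤-trans (∸-monoʳ-≤ k (n≤1+n d)) (n≤1+n (k ∸ d)))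
  where
  k∸d≤1+k∸[1+d] : ∀ k d → k ∸ d ≤ suc (k ∸ suc d)
  k∸d≤1+k∸[1+d] zero    zero    = z≤n
  k∸d≤1+k∸[1+d] zero    (suc d) = z≤n
  k∸d≤1+k∸[1+d] (suc k) zero    = ≤-refl
  k∸d≤1+k∸[1+d] (suc k) (suc d) = k∸d≤1+k∸[1+d] k d

wrapDist-reflect : ∀ {k d} → d ≤ k → wrapDist k (k ∸ d) ≡ wrapDist k d
wrapDist-reflect {k} {d} d≤k = trans (cong ((k ∸ d) ⊓_) (m∸[m∸n]≡n d≤k)) (⊓-comm (k ∸ d) d)

wrapDist-descent : ∀ k d {m} → wrapDist k (suc d) ≡ suc m →
                   wrapDist k d ≡ m ⊎ wrapDist k (suc (suc d)) ≡ m
wrapDist-descent k d {m} eq with ≤-total (suc d) (k ∸ suc d)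
... | inj₁ 1+d≤k∸[1+d] = inj₁ (begin
  d ⊓ (k ∸ d) ≡⟨ m≤n⇒m⊓n≡m d≤k∸d ⟩
  d           ≡⟨ suc-injective (trans (sym (m≤n⇒m⊓n≡m 1+d≤k∸[1+d])) eq) ⟩
  m           ∎)
  where
  open ≡-Reasoning
  d≤k∸d : d ≤ k ∸ d
  d≤k∸d = ≤-trans (n≤1+n d) (≤-trans 1+d≤k∸[1+d] (∸-monoʳ-≤ k (n≤1+n d)))
... | inj₂ k∸[1+d]≤1+d = inj₂ (begin
  suc (suc d) ⊓ (k ∸ suc (suc d)) ≡⟨ m≥n⇒m⊓n≡n k∸[2+d]≤2+d ⟩
  k ∸ suc (suc d)                 ≡⟨ pred[m∸n]≡m∸[1+n] k (suc d) ⟨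
  pred (k ∸ suc d)                ≡⟨ cong pred (trans (sym (m≥n⇒m⊓n≡n k∸[1+d]≤1+d)) eq) ⟩
  m                               ∎)
  where
  open ≡-Reasoning
  k∸[2+d]≤2+d : k ∸ suc (suc d) ≤ suc (suc d)
  k∸[2+d]≤2+d = ≤-trans (∸-monoʳ-≤ k (n≤1+n (suc d))) (≤-trans k∸[1+d]≤1+d (n≤1+n (suc d)))

data CycleEdge : ℕ → ℕ → ℕ → Set where
  forward       : ∀ {k} a → CycleEdge k a (suc a)
  backward      : ∀ {k} a → CycleEdge k (suc a) a
  wrap-backward : ∀ a → CycleEdge (suc a) 0 a
  wrap-forward  : ∀ a → CycleEdge (suc a) a 0

cycleEdge⁺ : ∀ {k a b} → CycleEdge k a b → T (cycleAdj k a b)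
cycleEdge⁺ (forward a)       = ∨-introˡ (≡ᵇ-refl (suc a))
cycleEdge⁺ (backward a)      = ∨-introʳ {suc (suc a) ≡ᵇ a} (∨-introˡ (≡ᵇ-refl (suc a)))
cycleEdge⁺ (wrap-backward a) = ∨-introʳ {1 ≡ᵇ a} (∨-introˡ (≡ᵇ-refl (suc a)))
cycleEdge⁺ (wrap-forward a)  =
  ∨-introʳ {1 ≡ᵇ a} (∨-introʳ {(a ≡ᵇ 0) ∧ (1 ≡ᵇ suc a)} (≡ᵇ-refl (suc a)))

cycleEdge⁻ : ∀ k a b → T (cycleAdj k a b) → CycleEdge k a b
cycleEdge⁻ k a b adj with Equivalence.to T-∨ adj
... | inj₁ 1+a≡b with refl ← ≡ᵇ⇒≡ (suc a) b 1+a≡b = forward a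
... | inj₂ adj′ with Equivalence.to T-∨ adj′
... | inj₁ 1+b≡a with refl ← ≡ᵇ⇒≡ (suc b) a 1+b≡a = backward b
... | inj₂ adj″ with Equivalence.to T-∨ adj″
... | inj₁ wrap with (a≡0 , 1+b≡k) ← Equivalence.to T-∧ wrap
                  with refl ← ≡ᵇ⇒≡ a 0 a≡0 | refl ← ≡ᵇ⇒≡ (suc b) k 1+b≡k = wrap-backward b
... | inj₂ wrap with (b≡0 , 1+a≡k) ← Equivalence.to T-∧ wrap
                  with refl ← ≡ᵇ⇒≡ b 0 b≡0 | refl ← ≡ᵇ⇒≡ (suc a) k 1+a≡k = wrap-forward a

∣suc-∣ : ∀ a b → ∣ suc a - b ∣ ≡ suc ∣ a - b ∣ ⊎ ∣ a - b ∣ ≡ suc ∣ suc a - b ∣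
∣suc-∣ a       zero    = inj₁ (cong suc (sym (∣-∣-identityʳ a)))
∣suc-∣ zero    (suc b) = inj₂ refl
∣suc-∣ (suc a) (suc b) = ∣suc-∣ a b

cycleDist-near-suc : ∀ k a b → Near (cycleDist k a b) (cycleDist k (suc a) b)
cycleDist-near-suc k a b with ∣suc-∣ a b
... | inj₁ eq rewrite eq = wrapDist-near k ∣ a - b ∣
... | inj₂ eq rewrite eq = near-sym (wrapDist-near k ∣ suc a - b ∣)

cycleDist-last : ∀ k b → b ≤ k → cycleDist (suc k) k b ≡ wrapDist (suc k) (suc b)
cycleDist-last k b b≤k =
  trans (cong (wrapDist (suc k)) (m≤n⇒∣n-m∣≡n∸m b≤k)) (wrapDist-reflect (s≤s b≤k))

cycleDist-near : ∀ {k a a′} b → b < k → CycleEdge k a a′ →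
                 Near (cycleDist k a b) (cycleDist k a′ b)
cycleDist-near         b b<k (forward a)       = cycleDist-near-suc _ a b
cycleDist-near         b b<k (backward a)      = near-sym (cycleDist-near-suc _ a b)
cycleDist-near {suc k} b b<k (wrap-backward k)
  rewrite cycleDist-last k b (s≤s⁻¹ b<k) = wrapDist-near (suc k) b
cycleDist-near {suc k} b b<k (wrap-forward k)
  rewrite cycleDist-last k b (s≤s⁻¹ b<k) = near-sym (wrapDist-near (suc k) b)

cycleDist-refl : ∀ k a → cycleDist k a a ≡ 0
cycleDist-refl k a = cong (wrapDist k) (∣n-n∣≡0 a)

cycleDist≡0⇒≡ : ∀ {k a b} → a < k → b < k → cycleDist k a b ≡ 0 → a ≡ b
cycleDist≡0⇒≡ {k} {a} {b} a<k b<k eq with ∣ a - b ∣ in δ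
... | zero  = ∣m-n∣≡0⇒m≡n δ
... | suc d with k ∸ suc d in κ
...   | zero  = contradiction (subst (_< k) δ (≤-<-trans (∣m-n∣≤m⊔n a b) (⊔-lub a<k b<k)))
                              (≤⇒≯ (m∸n≡0⇒m≤n κ))
...   | suc _ with () ← eq

∣m-1+m+n∣≡1+n : ∀ m n → ∣ m - suc (m + n) ∣ ≡ suc n
∣m-1+m+n∣≡1+n m n = trans (cong (∣ m -_∣) (sym (+-suc m n))) (∣m-m+n∣≡n m (suc n))

∣1+m+n-m∣≡1+n : ∀ m n → ∣ suc (m + n) - m ∣ ≡ suc n
∣1+m+n-m∣≡1+n m n = trans (∣-∣-comm (suc (m + n)) m) (∣m-1+m+n∣≡1+n m n)

CycleStep : ℕ → ℕ → ℕ → ℕ → Set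
CycleStep k a b m = ∃[ a′ ] a′ < k × CycleEdge k a a′ × cycleDist k a′ b ≡ m

cycleStep-wrap-backward : ∀ {k b m} → b < k → wrapDist k (suc b) ≡ m → CycleStep k 0 b m
cycleStep-wrap-backward {suc k} {b} b<k eq =
  k , n<1+n k , wrap-backward k , trans (cycleDist-last k b (s≤s⁻¹ b<k)) eq

-- The gap between a and b is d + 1.  Step towards b when that shortens the way along the cycle,
-- otherwise step away from b, possibly around from one end of 0 .. k - 1 to the other.

cycleStep-up : ∀ {k} a d {m} → suc (a + d) < k → cycleDist k a (suc (a + d)) ≡ suc m →
               CycleStep k a (suc (a + d)) m
cycleStep-up {k} a d b<k eq
  with wrapDist-descent k d (trans (cong (wrapDist k) (sym (∣m-1+m+n∣≡1+n a d))) eq)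
... | inj₁ eq′ = suc a , ≤-<-trans (s≤s (m≤m+n a d)) b<k , forward a ,
                 trans (cong (wrapDist k) (∣m-m+n∣≡n a d)) eq′
cycleStep-up {k} zero    d b<k eq | inj₂ eq′ = cycleStep-wrap-backward b<k eq′
cycleStep-up {k} (suc a) d b<k eq | inj₂ eq′ =
  a , ≤-<-trans (m≤n⇒m≤1+n (m≤n⇒m≤1+n (m≤m+n a d))) b<k , backward a ,
  trans (cong (wrapDist k) gap) eq′
  where
  gap : ∣ a - suc (suc a + d) ∣ ≡ suc (suc d)
  gap = trans (cong (λ x → ∣ a - suc x ∣) (sym (+-suc a d))) (∣m-1+m+n∣≡1+n a (suc d))

cycleStep-down : ∀ {k} b d {m} → suc (b + d) < k → cycleDist k (suc (b + d)) b ≡ suc m →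
                 CycleStep k (suc (b + d)) b m
cycleStep-down {k} b d a<k eq
  with wrapDist-descent k d (trans (cong (wrapDist k) (sym (∣1+m+n-m∣≡1+n b d))) eq)
... | inj₁ eq′ = b + d , <-trans (n<1+n (b + d)) a<k , backward (b + d) ,
                 trans (cong (wrapDist k) (trans (∣-∣-comm (b + d) b) (∣m-m+n∣≡n b d))) eq′
... | inj₂ eq′ with m≤n⇒m<n∨m≡n a<k
...   | inj₁ 1+a<k = suc (suc (b + d)) , 1+a<k , forward (suc (b + d)) , trans (cong (wrapDist k) gap) eq′
  where
  gap : ∣ suc (suc (b + d)) - b ∣ ≡ suc (suc d)
  gap = trans (cong (λ x → ∣ suc x - b ∣) (sym (+-suc b d))) (∣1+m+n-m∣≡1+n b (suc d))
...   | inj₂ refl    = 0 , z<s , wrap-forward (suc (b + d)) , (begin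
  wrapDist k b                   ≡⟨ wrapDist-reflect b≤k ⟨
  wrapDist k (k ∸ b)             ≡⟨ cong (wrapDist k) k∸b≡2+d ⟩
  wrapDist k (suc (suc d))       ≡⟨ eq′ ⟩
  _                              ∎)
  where
  open ≡-Reasoning
  b≤k : b ≤ suc (suc (b + d))
  b≤k = ≤-trans (m≤m+n b d) (≤-trans (n≤1+n (b + d)) (n≤1+n (suc (b + d))))
  k∸b≡2+d : suc (suc (b + d)) ∸ b ≡ suc (suc d)
  k∸b≡2+d = trans (cong (_∸ b) (sym (trans (+-suc b (suc d)) (cong suc (+-suc b d)))))
                  (m+n∸m≡n b (suc (suc d)))

cycleDist-descent : ∀ {k a b m} → a < k → b < k → cycleDist k a b ≡ suc m → CycleStep k a b m
cycleDist-descent {k} {a} {b} a<k b<k eq with <-cmp a b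
... | tri≈ _ refl _ = contradiction (trans (sym (cycleDist-refl k a)) eq) 0≢1+n
... | tri< a<b _ _ with d , refl ← m≤n⇒∃[o]m+o≡n a<b = cycleStep-up a d b<k eq
... | tri> _ _ b<a with d , refl ← m≤n⇒∃[o]m+o≡n b<a = cycleStep-down b d a<k eq

-- Distance in the ortho-chain

chainDist : ℕ → ℕ → ℕ → ℕ → ℕ → ℕ
chainDist k (suc i) a (suc j) b = chainDist k i a j b
chainDist k zero    a zero    b = cycleDist k a b
chainDist k zero    a (suc j) b = cycleDist k a 1 + suc (chainDist k zero 0 j b)
chainDist k (suc i) a zero    b = cycleDist k a 0 + suc (chainDist k i 1 zero b)

data ChainEdge (k : ℕ) : ℕ → ℕ → ℕ → ℕ → Set where
  along   : ∀ {i a a′} → CycleEdge k a a′ → ChainEdge k i a i a′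
  bridge⁺ : ∀ i → ChainEdge k i 1 (suc i) 0
  bridge⁻ : ∀ i → ChainEdge k (suc i) 0 i 1

chainEdge⁺ : ∀ {h k i a i′ a′} → ChainEdge k i a i′ a′ → T (orthoChainAdj h k i a i′ a′)
chainEdge⁺ {i = i} (along e)   = ∨-introˡ (∧-intro (≡ᵇ-refl i) (cycleEdge⁺ e))
chainEdge⁺ {k = k} (bridge⁺ i) =
  ∨-introʳ {(i ≡ᵇ suc i) ∧ cycleAdj k 1 0} (∨-introˡ (∧-intro (≡ᵇ-refl (suc i)) _))
chainEdge⁺ {k = k} (bridge⁻ i) =
  ∨-introʳ {(suc i ≡ᵇ i) ∧ cycleAdj k 0 1}
           (∨-introʳ {(suc (suc i) ≡ᵇ i) ∧ false} (∧-intro (≡ᵇ-refl (suc i)) _))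

chainEdge⁻ : ∀ h k i a i′ a′ → T (orthoChainAdj h k i a i′ a′) → ChainEdge k i a i′ a′
chainEdge⁻ h k i a i′ a′ adj with Equivalence.to T-∨ adj
... | inj₁ adj′ with i≡i′ , e ← Equivalence.to T-∧ adj′
                with refl ← ≡ᵇ⇒≡ i i′ i≡i′ = along (cycleEdge⁻ k a a′ e)
... | inj₂ adj′ with Equivalence.to T-∨ adj′
... | inj₁ fwd with 1+i≡i′ , a≡1∧a′≡0 ← Equivalence.to T-∧ fwd
               with a≡1 , a′≡0 ← Equivalence.to T-∧ a≡1∧a′≡0
               with refl ← ≡ᵇ⇒≡ (suc i) i′ 1+i≡i′ | refl ← ≡ᵇ⇒≡ a 1 a≡1 | refl ← ≡ᵇ⇒≡ a′ 0 a′≡0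
  = bridge⁺ i
... | inj₂ bwd with 1+i′≡i , a′≡1∧a≡0 ← Equivalence.to T-∧ bwd
               with a′≡1 , a≡0 ← Equivalence.to T-∧ a′≡1∧a≡0
               with refl ← ≡ᵇ⇒≡ (suc i′) i 1+i′≡i | refl ← ≡ᵇ⇒≡ a′ 1 a′≡1 | refl ← ≡ᵇ⇒≡ a 0 a≡0
  = bridge⁻ i′

chainDist-refl : ∀ k i a → chainDist k i a i a ≡ 0
chainDist-refl k zero    a = cycleDist-refl k a
chainDist-refl k (suc i) a = chainDist-refl k i a

chainDist≡0 : ∀ {k a b} i j → a < k → b < k → chainDist k i a j b ≡ 0 → i ≡ j × a ≡ b
chainDist≡0 zero    zero    a<k b<k eq = refl , cycleDist≡0⇒≡ a<k b<k eq
chainDist≡0 (suc i) (suc j) a<k b<k eq with refl , a≡b ← chainDist≡0 i j a<k b<k eq = refl , a≡b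
chainDist≡0 {k} {a} zero    (suc j) a<k b<k eq = contradiction eq (m+1+n≢0 (cycleDist k a 1))
chainDist≡0 {k} {a} (suc i) zero    a<k b<k eq = contradiction eq (m+1+n≢0 (cycleDist k a 0))

chainDist-bridge : ∀ k i j b → Near (chainDist k i 1 j b) (chainDist k (suc i) 0 j b)
chainDist-bridge k zero    zero    b = near-suc (cycleDist k 1 b)
chainDist-bridge k zero    (suc j) b = near-sym (near-suc (chainDist k zero 0 j b))
chainDist-bridge k (suc i) zero    b = near-suc (chainDist k (suc i) 1 zero b)
chainDist-bridge k (suc i) (suc j) b = chainDist-bridge k i j b

chainDist-along : ∀ {k a a′} i j b → 1 < k → b < k → CycleEdge k a a′ →
                  Near (chainDist k i a j b) (chainDist k i a′ j b)
chainDist-along zero    zero    b 1<k b<k e = cycleDist-near b b<k e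
chainDist-along zero    (suc j) b 1<k b<k e = near-+ʳ _ (cycleDist-near 1 1<k e)
chainDist-along (suc i) zero    b 1<k b<k e = near-+ʳ _ (cycleDist-near 0 (<-trans z<s 1<k) e)
chainDist-along (suc i) (suc j) b 1<k b<k e = chainDist-along i j b 1<k b<k e

chainDist-near : ∀ {k i a i′ a′} j b → 1 < k → b < k → ChainEdge k i a i′ a′ →
                 Near (chainDist k i a j b) (chainDist k i′ a′ j b)
chainDist-near {i = i} j b 1<k b<k (along e)   = chainDist-along i j b 1<k b<k e
chainDist-near {k}     j b 1<k b<k (bridge⁺ i) = chainDist-bridge k i j b
chainDist-near {k}     j b 1<k b<k (bridge⁻ i) = near-sym (chainDist-bridge k i j b)

chainEdge-suc : ∀ {k i a i′ a′} → ChainEdge k i a i′ a′ → ChainEdge k (suc i) a (suc i′) a′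
chainEdge-suc (along e)   = along e
chainEdge-suc (bridge⁺ i) = bridge⁺ (suc i)
chainEdge-suc (bridge⁻ i) = bridge⁻ (suc i)

ChainStep : ℕ → ℕ → ℕ → ℕ → ℕ → ℕ → Set
ChainStep k i a j b m =
  ∃[ i′ ] ∃[ a′ ] i′ ≤ i ⊔ j × a′ < k × ChainEdge k i a i′ a′ × chainDist k i′ a′ j b ≡ m

chainDist-descent : ∀ {k a b m} i j → 1 < k → a < k → b < k → chainDist k i a j b ≡ suc m →
                    ChainStep k i a j b m
chainDist-descent zero zero 1<k a<k b<k eq with a′ , a′<k , e , eq′ ← cycleDist-descent a<k b<k eq =
  zero , a′ , z≤n , a′<k , along e , eq′
chainDist-descent (suc i) (suc j) 1<k a<k b<k eq
  with i′ , a′ , i′≤i⊔j , a′<k , e , eq′ ← chainDist-descent i j 1<k a<k b<k eq =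
  suc i′ , a′ , s≤s i′≤i⊔j , a′<k , chainEdge-suc e , eq′
chainDist-descent {k} {a} zero (suc j) 1<k a<k b<k eq with cycleDist k a 1 in δ
... | zero with refl ← cycleDist≡0⇒≡ a<k 1<k δ =
  1 , 0 , s≤s z≤n , <-trans z<s 1<k , bridge⁺ 0 , suc-injective eq
... | suc _ with a′ , a′<k , e , eq′ ← cycleDist-descent a<k 1<k δ =
  zero , a′ , z≤n , a′<k , along e , trans (cong (_+ _) eq′) (suc-injective eq)
chainDist-descent {k} {a} (suc i) zero 1<k a<k b<k eq with cycleDist k a 0 in δ
... | zero with refl ← cycleDist≡0⇒≡ a<k (<-trans z<s 1<k) δ =
  i , 1 , n≤1+n i , 1<k , bridge⁻ i , suc-injective eq
... | suc _ with a′ , a′<k , e , eq′ ← cycleDist-descent a<k (<-trans z<s 1<k) δ =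
  suc i , a′ , ≤-refl , a′<k , along e , trans (cong (_+ _) eq′) (suc-injective eq)

module Coordinates (h k : ℕ) where

  gon : Fin (h * k) → ℕ
  gon x = toℕ (proj₁ (remQuot {h} k x))

  pos : Fin (h * k) → ℕ
  pos x = toℕ (proj₂ (remQuot {h} k x))

  orthoChain≡ : ∀ x y → orthoChain h k x y ≡ orthoChainAdj h k (gon x) (pos x) (gon y) (pos y)
  orthoChain≡ x y with remQuot {h} k x | remQuot {h} k y
  ... | _ , _ | _ , _ = refl

  coordinates-injective : ∀ {x y} → gon x ≡ gon y → pos x ≡ pos y → x ≡ y
  coordinates-injective {x} {y} gx≡gy px≡py = begin
    x                                 ≡⟨ combine-remQuot {h} k x ⟨
    uncurry combine (remQuot {h} k x) ≡⟨ cong (uncurry combine) (cong₂ _,_ (toℕ-injective gx≡gy)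
                                                                           (toℕ-injective px≡py)) ⟩
    uncurry combine (remQuot {h} k y) ≡⟨ combine-remQuot {h} k y ⟩
    y                                 ∎
    where open ≡-Reasoning

  vertex : ∀ {i a} → i < h → a < k → Fin (h * k)
  vertex i<h a<k = combine (fromℕ< i<h) (fromℕ< a<k)

  gon-vertex : ∀ {i a} (i<h : i < h) (a<k : a < k) → gon (vertex i<h a<k) ≡ i
  gon-vertex i<h a<k =
    trans (cong (toℕ ∘ proj₁) (remQuot-combine (fromℕ< i<h) (fromℕ< a<k))) (toℕ-fromℕ< i<h)

  pos-vertex : ∀ {i a} (i<h : i < h) (a<k : a < k) → pos (vertex i<h a<k) ≡ a
  pos-vertex i<h a<k =
    trans (cong (toℕ ∘ proj₂) (remQuot-combine (fromℕ< i<h) (fromℕ< a<k))) (toℕ-fromℕ< a<k)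

  gon<h : ∀ x → gon x < h
  gon<h x = toℕ<n (proj₁ (remQuot {h} k x))

  pos<k : ∀ x → pos x < k
  pos<k x = toℕ<n (proj₂ (remQuot {h} k x))

  distTo : Fin (h * k) → Fin (h * k) → ℕ
  distTo v u = chainDist k (gon u) (pos u) (gon v) (pos v)

  distTo-isDistanceTo : 1 < k → ∀ v → IsDistanceTo (orthoChain h k) v (distTo v)
  distTo-isDistanceTo 1<k v = record
    { zero⇒target = λ u eq → let gu≡gv , pu≡pv = chainDist≡0 (gon u) (gon v) (pos<k u) (pos<k v) eq
                             in coordinates-injective gu≡gv pu≡pv
    ; target      = chainDist-refl k (gon v) (pos v)
    ; lipschitz   = λ u w uw → proj₁ (chainDist-near (gon v) (pos v) 1<k (pos<k v) (edge u w uw))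
    ; descent     = step
    }
    where
    edge : ∀ u w → T (orthoChain h k u w) → ChainEdge k (gon u) (pos u) (gon w) (pos w)
    edge u w uw = chainEdge⁻ h k _ _ _ _ (subst T (orthoChain≡ u w) uw)

    step : ∀ u {m} → distTo v u ≡ suc m → ∃[ w ] T (orthoChain h k u w) × distTo v w ≡ m
    step u {m} eq
      with i′ , a′ , i′≤ , a′<k , e , eq′ ← chainDist-descent (gon u) (gon v) 1<k (pos<k u) (pos<k v) eq
      = w , u→w , Dw≡m
      where
      i′<h : i′ < h
      i′<h = ≤-<-trans i′≤ (⊔-lub (gon<h u) (gon<h v))
      w : Fin (h * k)
      w = vertex i′<h a′<k
      u→w : T (orthoChain h k u w)
      u→w rewrite orthoChain≡ u w | gon-vertex i′<h a′<k | pos-vertex i′<h a′<k = chainEdge⁺ {h} e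
      Dw≡m : distTo v w ≡ m
      Dw≡m rewrite gon-vertex i′<h a′<k | pos-vertex i′<h a′<k = eq′

  dist3-orthoChain : 1 < k → ∀ u v → dist3 (orthoChain h k) u v ≡ (distTo v u ≡ᵇ 3)
  dist3-orthoChain 1<k u v = IsDistanceTo.dist3≡ (distTo-isDistanceTo 1<k v) u

-- Counting the pairs at distance three

lexLess : ℕ → ℕ → ℕ → ℕ → Bool
lexLess (suc i) a (suc j) b = lexLess i a j b
lexLess zero    a zero    b = a <ᵇ b
lexLess zero    a (suc j) b = true
lexLess (suc i) a zero    b = false

+-cancelˡ-<ᵇ : ∀ c x y → (c + x <ᵇ c + y) ≡ (x <ᵇ y)
+-cancelˡ-<ᵇ zero    x y = refl
+-cancelˡ-<ᵇ (suc c) x y = +-cancelˡ-<ᵇ c x y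

mixedRadix-<ᵇ : ∀ {k a b} i j → a < k → b < k → (k * i + a <ᵇ k * j + b) ≡ lexLess i a j b
mixedRadix-<ᵇ {k} {a} {b} zero zero a<k b<k =
  cong₂ _<ᵇ_ (cong (_+ a) (*-zeroʳ k)) (cong (_+ b) (*-zeroʳ k))
mixedRadix-<ᵇ {k} {a} {b} (suc i) (suc j) a<k b<k = begin
  (k * suc i + a <ᵇ k * suc j + b)     ≡⟨ cong₂ _<ᵇ_ (shift i a) (shift j b) ⟩
  (k + (k * i + a) <ᵇ k + (k * j + b)) ≡⟨ +-cancelˡ-<ᵇ k _ _ ⟩
  (k * i + a <ᵇ k * j + b)             ≡⟨ mixedRadix-<ᵇ i j a<k b<k ⟩
  lexLess i a j b                      ∎
  where
  open ≡-Reasoning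
  shift : ∀ i a → k * suc i + a ≡ k + (k * i + a)
  shift i a = trans (cong (_+ a) (*-suc k i)) (+-assoc k (k * i) a)
mixedRadix-<ᵇ {k} {a} {b} zero (suc j) a<k b<k = dec-true (_ <? _) (begin-strict
  k * 0 + a     ≡⟨ cong (_+ a) (*-zeroʳ k) ⟩
  a             <⟨ a<k ⟩
  k             ≤⟨ m≤m*n k (suc j) ⟩
  k * suc j     ≤⟨ m≤m+n (k * suc j) b ⟩
  k * suc j + b ∎)
  where open ≤-Reasoning
mixedRadix-<ᵇ {k} {a} {b} (suc i) zero a<k b<k = dec-false (_ <? _) (≤⇒≯ (begin
  k * 0 + b     ≡⟨ cong (_+ b) (*-zeroʳ k) ⟩
  b             ≤⟨ <⇒≤ b<k ⟩
  k             ≤⟨ m≤m*n k (suc i) ⟩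
  k * suc i     ≤⟨ m≤m+n (k * suc i) a ⟩
  k * suc i + a ∎))
  where open ≤-Reasoning

atDist3 : ℕ → ℕ → ℕ → ℕ → ℕ → ℕ
atDist3 k i a j b = 𝟙 (lexLess i a j b ∧ (chainDist k i a j b ≡ᵇ 3))

chainWp : ℕ → ℕ → ℕ
chainWp h k = ∑[ i < h ] ∑[ a < k ] ∑[ j < h ] ∑[ b < k ] atDist3 k (toℕ i) (toℕ a) (toℕ j) (toℕ b)

Wp-orthoChain : ∀ h k → 1 < k → Wp (orthoChain h k) ≡ chainWp h k
Wp-orthoChain h k 1<k = begin
  Wp (orthoChain h k)
    ≡⟨ Wp≡∑ (orthoChain h k) ⟩
  ∑[ u < h * k ] ∑[ v < h * k ] 𝟙 ((toℕ u <ᵇ toℕ v) ∧ dist3 (orthoChain h k) u v)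
    ≡⟨ sum-cong-≗ (λ u → sum-cong-≗ (λ v → cong (λ d → 𝟙 ((toℕ u <ᵇ toℕ v) ∧ d))
                                               (dist3-orthoChain 1<k u v))) ⟩
  ∑[ u < h * k ] ∑[ v < h * k ] 𝟙 ((toℕ u <ᵇ toℕ v) ∧ (distTo v u ≡ᵇ 3))
    ≡⟨ ∑-combine h k _ ⟩
  ∑[ i < h ] ∑[ a < k ] ∑[ v < h * k ] 𝟙 ((toℕ (combine i a) <ᵇ toℕ v) ∧ (distTo v (combine i a) ≡ᵇ 3))
    ≡⟨ sum-cong-≗ (λ i → sum-cong-≗ (λ a →
         trans (∑-combine h k _) (sum-cong-≗ (λ j → sum-cong-≗ (λ b → pair i a j b))))) ⟩
  chainWp h k ∎
  where
  open ≡-Reasoning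
  open Coordinates h k
  gon-combine : ∀ i a → gon (combine i a) ≡ toℕ i
  gon-combine i a = cong (toℕ ∘ proj₁) (remQuot-combine i a)
  pos-combine : ∀ i a → pos (combine i a) ≡ toℕ a
  pos-combine i a = cong (toℕ ∘ proj₂) (remQuot-combine i a)
  pair : ∀ i a j b →
         𝟙 ((toℕ (combine i a) <ᵇ toℕ (combine j b)) ∧ (distTo (combine j b) (combine i a) ≡ᵇ 3))
         ≡ atDist3 k (toℕ i) (toℕ a) (toℕ j) (toℕ b)
  pair i a j b rewrite toℕ-combine i a | toℕ-combine j b
                     | gon-combine i a | pos-combine i a | gon-combine j b | pos-combine j b
                     | mixedRadix-<ᵇ (toℕ i) (toℕ j) (toℕ<n a) (toℕ<n b) = refl

cycleWp : ℕ → ℕ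
cycleWp k = ∑[ a < k ] ∑[ b < k ] 𝟙 ((toℕ a <ᵇ toℕ b) ∧ (cycleDist k (toℕ a) (toℕ b) ≡ᵇ 3))

crossPairs : ℕ → ℕ → ℕ
crossPairs k j = ∑[ a < k ] ∑[ b < k ] 𝟙 (chainDist k zero (toℕ a) (suc j) (toℕ b) ≡ᵇ 3)

chainWp-suc : ∀ h k → chainWp (suc h) k ≡ cycleWp k + ∑[ j < h ] crossPairs k (toℕ j) + chainWp h k
chainWp-suc h k = cong₂ _+_ firstGon laterGons
  where
  firstGon : ∑[ a < k ] (∑[ b < k ] atDist3 k 0 (toℕ a) 0 (toℕ b)
                        + ∑[ j < h ] ∑[ b < k ] atDist3 k 0 (toℕ a) (suc (toℕ j)) (toℕ b))
           ≡ cycleWp k + ∑[ j < h ] crossPairs k (toℕ j)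
  firstGon = trans (∑-distrib-+ {k} (λ a → ∑[ b < k ] atDist3 k 0 (toℕ a) 0 (toℕ b))
                                    (λ a → ∑[ j < h ] cross a j))
                   (cong (cycleWp k +_) (∑-comm {k} {h} cross))
    where
    cross : Fin k → Fin h → ℕ
    cross a j = ∑[ b < k ] atDist3 k 0 (toℕ a) (suc (toℕ j)) (toℕ b)
  laterGons : ∑[ i < h ] ∑[ a < k ] (∑[ b < k ] atDist3 k (suc (toℕ i)) (toℕ a) 0 (toℕ b)
                                   + ∑[ j < h ] ∑[ b < k ] atDist3 k (toℕ i) (toℕ a) (toℕ j) (toℕ b))
            ≡ chainWp h k
  laterGons = sum-cong-≗ {h} (λ i → sum-cong-≗ {k} (λ a → cong₂ _+_ (∑-zero k) refl))

crossPairs-far : ∀ k j → 1 < k → crossPairs k (suc (suc j)) ≡ 0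
crossPairs-far 1             j (s≤s ())
crossPairs-far (suc (suc k)) j _ =
  trans (sum-cong-≗ {2 + k} (λ a → trans (sum-cong-≗ {2 + k} (λ b → cong 𝟙 (tooFar a b)))
                                          (∑-zero (2 + k))))
        (∑-zero (2 + k))
  where
  tooFar : ∀ a b → (chainDist (2 + k) 0 (toℕ a) (3 + j) (toℕ b) ≡ᵇ 3) ≡ false
  tooFar a b = dec-false (_ ≟ 3) (>⇒≢ (≤-trans (m≤m+n 4 _) (m≤n+m _ (cycleDist (2 + k) (toℕ a) 1))))

chainWp-closed : ∀ h k → 1 < k →
  chainWp (2 + h) k ≡ (2 + h) * cycleWp k + (1 + h) * crossPairs k 0 + h * crossPairs k 1
chainWp-closed h k 1<k = closed h
  where
  open ≡-Reasoning
  W X Y : ℕ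
  W = cycleWp k
  X = crossPairs k 0
  Y = crossPairs k 1

  two-gons : ∀ w x y → w + (x + 0) + (w + 0 + 0) ≡ 2 * w + 1 * x + 0 * y
  two-gons = solve-∀

  one-more-gon : ∀ h w x y → w + (x + (y + 0)) + ((2 + h) * w + (1 + h) * x + h * y)
                           ≡ (3 + h) * w + (2 + h) * x + (1 + h) * y
  one-more-gon = solve-∀

  closed : ∀ h → chainWp (2 + h) k ≡ (2 + h) * W + (1 + h) * X + h * Y
  closed zero = begin
    chainWp 2 k                ≡⟨ chainWp-suc 1 k ⟩
    W + (X + 0) + chainWp 1 k  ≡⟨ cong (W + (X + 0) +_) (chainWp-suc 0 k) ⟩
    W + (X + 0) + (W + 0 + 0)  ≡⟨ two-gons W X Y ⟩
    2 * W + 1 * X + 0 * Y      ∎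
  closed (suc h) = begin
    chainWp (3 + h) k
      ≡⟨ chainWp-suc (2 + h) k ⟩
    W + (X + (Y + ∑[ j < h ] crossPairs k (2 + toℕ j))) + chainWp (2 + h) k
      ≡⟨ cong₂ (λ r s → W + (X + (Y + r)) + s) farGons (closed h) ⟩
    W + (X + (Y + 0)) + ((2 + h) * W + (1 + h) * X + h * Y)
      ≡⟨ one-more-gon h W X Y ⟩
    (3 + h) * W + (2 + h) * X + (1 + h) * Y ∎
    where
    farGons : ∑[ j < h ] crossPairs k (2 + toℕ j) ≡ 0
    farGons = trans (sum-cong-≗ {h} (λ j → crossPairs-far k (toℕ j) 1<k)) (∑-zero h)

Wp-orthoChain-closed : ∀ h k → 1 < k →
  Wp (orthoChain (2 + h) k) ≡ (2 + h) * cycleWp k + (1 + h) * crossPairs k 0 + h * crossPairs k 1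
Wp-orthoChain-closed h k 1<k = trans (Wp-orthoChain (2 + h) k 1<k) (chainWp-closed h k 1<k)

-- Pairs at distance three on one and on two cycles

+-cancelˡ-≡ᵇ : ∀ c x y → (c + x ≡ᵇ c + y) ≡ (x ≡ᵇ y)
+-cancelˡ-≡ᵇ zero    x y = refl
+-cancelˡ-≡ᵇ (suc c) x y = +-cancelˡ-≡ᵇ c x y

𝟙-wrapDist≡ : ∀ {k t d} → t + t < k → d < k →
               𝟙 (wrapDist k d ≡ᵇ t) ≡ 𝟙 (d ≡ᵇ t) + 𝟙 (d ≡ᵇ k ∸ t)
𝟙-wrapDist≡ {k} {t} {d} 2t<k d<k with d ≟ t | d ≟ k ∸ t
... | yes refl | _ = begin
  𝟙 (wrapDist k t ≡ᵇ t)              ≡⟨ ≡⇒𝟙≡1 (m≤n⇒m⊓n≡m t≤k∸t) ⟩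
  1                                  ≡⟨ cong₂ _+_ (≡⇒𝟙≡1 {t} refl) (≢⇒𝟙≡0 t≢k∸t) ⟨
  𝟙 (t ≡ᵇ t) + 𝟙 (t ≡ᵇ k ∸ t)        ∎
  where
  open ≡-Reasoning
  t≤k∸t : t ≤ k ∸ t
  t≤k∸t = m+n≤o⇒m≤o∸n t (<⇒≤ 2t<k)
  t≢k∸t : t ≢ k ∸ t
  t≢k∸t t≡k∸t = <⇒≢ 2t<k (trans (cong (_+ t) t≡k∸t) (m∸n+n≡m (≤-trans (m≤m+n t t) (<⇒≤ 2t<k))))
... | no d≢t | yes refl = begin
  𝟙 (wrapDist k (k ∸ t) ≡ᵇ t)         ≡⟨ ≡⇒𝟙≡1 (trans (wrapDist-reflect t≤k) (m≤n⇒m⊓n≡m t≤k∸t)) ⟩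
  1                                   ≡⟨ cong₂ _+_ (≢⇒𝟙≡0 d≢t) (≡⇒𝟙≡1 {k ∸ t} refl) ⟨
  𝟙 (k ∸ t ≡ᵇ t) + 𝟙 (k ∸ t ≡ᵇ k ∸ t) ∎
  where
  open ≡-Reasoning
  t≤k : t ≤ k
  t≤k = ≤-trans (m≤m+n t t) (<⇒≤ 2t<k)
  t≤k∸t : t ≤ k ∸ t
  t≤k∸t = m+n≤o⇒m≤o∸n t (<⇒≤ 2t<k)
... | no d≢t | no d≢k∸t =
  trans (≢⇒𝟙≡0 wrapDist≢t) (sym (cong₂ _+_ (≢⇒𝟙≡0 d≢t) (≢⇒𝟙≡0 d≢k∸t)))
  where
  wrapDist≢t : wrapDist k d ≢ t
  wrapDist≢t eq with ≤-total d (k ∸ d)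
  ... | inj₁ d≤k∸d = d≢t (trans (sym (m≤n⇒m⊓n≡m d≤k∸d)) eq)
  ... | inj₂ k∸d≤d =
    d≢k∸t (trans (sym (m∸[m∸n]≡n (<⇒≤ d<k))) (cong (k ∸_) (trans (sym (m≥n⇒m⊓n≡n k∸d≤d)) eq)))

𝟙-<∧cycleDist≡3 : ∀ {k a b} → 3 + 3 < k → b < k →
  𝟙 ((a <ᵇ b) ∧ (cycleDist k a b ≡ᵇ 3)) ≡ 𝟙 (b ≡ᵇ a + 3) + 𝟙 (b ≡ᵇ a + (k ∸ 3))
𝟙-<∧cycleDist≡3 {k} {a} {b} 6<k b<k with a <? b
... | yes a<b with d , refl ← m≤n⇒∃[o]m+o≡n (<⇒≤ a<b) = begin
  𝟙 ((a <ᵇ a + d) ∧ (cycleDist k a (a + d) ≡ᵇ 3))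
    ≡⟨ cong (λ x → 𝟙 (x ∧ (cycleDist k a (a + d) ≡ᵇ 3))) (dec-true (a <? a + d) a<b) ⟩
  𝟙 (wrapDist k ∣ a - a + d ∣ ≡ᵇ 3)
    ≡⟨ cong (λ x → 𝟙 (wrapDist k x ≡ᵇ 3)) (∣m-m+n∣≡n a d) ⟩
  𝟙 (wrapDist k d ≡ᵇ 3)
    ≡⟨ 𝟙-wrapDist≡ 6<k (≤-<-trans (m≤n+m d a) b<k) ⟩
  𝟙 (d ≡ᵇ 3) + 𝟙 (d ≡ᵇ k ∸ 3)
    ≡⟨ cong₂ (λ x y → 𝟙 x + 𝟙 y) (+-cancelˡ-≡ᵇ a d 3) (+-cancelˡ-≡ᵇ a d (k ∸ 3)) ⟨
  𝟙 (a + d ≡ᵇ a + 3) + 𝟙 (a + d ≡ᵇ a + (k ∸ 3)) ∎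
  where open ≡-Reasoning
... | no a≮b = begin
  𝟙 ((a <ᵇ b) ∧ (cycleDist k a b ≡ᵇ 3))
    ≡⟨ cong (λ x → 𝟙 (x ∧ (cycleDist k a b ≡ᵇ 3))) (dec-false (a <? b) a≮b) ⟩
  0
    ≡⟨ cong₂ _+_ (≢⇒𝟙≡0 (below 3 z<s)) (≢⇒𝟙≡0 (below (k ∸ 3) (m<n⇒0<n∸m 3<k))) ⟨
  𝟙 (b ≡ᵇ a + 3) + 𝟙 (b ≡ᵇ a + (k ∸ 3)) ∎
  where
  open ≡-Reasoning
  3<k : 3 < k
  3<k = ≤-trans (s≤s (m≤m+n 3 3)) 6<k
  below : ∀ c → 0 < c → b ≢ a + c
  below c 0<c = <⇒≢ (≤-<-trans (≮⇒≥ a≮b) (m<m+n a 0<c))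

cycleWp-large : ∀ k → 7 ≤ k → cycleWp k ≡ k
cycleWp-large k 7≤k = begin
  cycleWp k
    ≡⟨ sum-cong-≗ {k} (λ a → sum-cong-≗ {k} (λ b → 𝟙-<∧cycleDist≡3 7≤k (toℕ<n b))) ⟩
  ∑[ a < k ] ∑[ b < k ] (𝟙 (toℕ b ≡ᵇ toℕ a + 3) + 𝟙 (toℕ b ≡ᵇ toℕ a + (k ∸ 3)))
    ≡⟨ sum-cong-≗ {k} (λ a → trans (∑-distrib-+ {k} (λ b → 𝟙 (toℕ b ≡ᵇ toℕ a + 3))
                                                    (λ b → 𝟙 (toℕ b ≡ᵇ toℕ a + (k ∸ 3))))
                                   (cong₂ _+_ (∑-𝟙-≡ k (toℕ a + 3)) (∑-𝟙-≡ k (toℕ a + (k ∸ 3))))) ⟩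
  ∑[ a < k ] (𝟙 (toℕ a + 3 <ᵇ k) + 𝟙 (toℕ a + (k ∸ 3) <ᵇ k))
    ≡⟨ trans (∑-distrib-+ {k} (λ a → 𝟙 (toℕ a + 3 <ᵇ k)) (λ a → 𝟙 (toℕ a + (k ∸ 3) <ᵇ k)))
             (cong₂ _+_ (∑-𝟙-< k 3) (∑-𝟙-< k (k ∸ 3))) ⟩
  (k ∸ 3) + (k ∸ (k ∸ 3))
    ≡⟨ cong ((k ∸ 3) +_) (m∸[m∸n]≡n 3≤k) ⟩
  (k ∸ 3) + 3
    ≡⟨ m∸n+n≡m 3≤k ⟩
  k ∎
  where
  open ≡-Reasoning
  3≤k : 3 ≤ k
  3≤k = ≤-trans (m≤m+n 3 4) 7≤k

sphereSize : ℕ → ℕ → ℕ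
sphereSize k t = ∑[ b < k ] 𝟙 (cycleDist k 0 (toℕ b) ≡ᵇ t)

sphereSize≡ : ∀ {k t} → t + t < k → sphereSize k t ≡ 𝟙 (t <ᵇ k) + 𝟙 (k ∸ t <ᵇ k)
sphereSize≡ {k} {t} 2t<k = begin
  ∑[ b < k ] 𝟙 (wrapDist k (toℕ b) ≡ᵇ t)
    ≡⟨ sum-cong-≗ {k} (λ b → 𝟙-wrapDist≡ 2t<k (toℕ<n b)) ⟩
  ∑[ b < k ] (𝟙 (toℕ b ≡ᵇ t) + 𝟙 (toℕ b ≡ᵇ k ∸ t))
    ≡⟨ ∑-distrib-+ {k} (λ b → 𝟙 (toℕ b ≡ᵇ t)) (λ b → 𝟙 (toℕ b ≡ᵇ k ∸ t)) ⟩
  ∑[ b < k ] 𝟙 (toℕ b ≡ᵇ t) + ∑[ b < k ] 𝟙 (toℕ b ≡ᵇ k ∸ t)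
    ≡⟨ cong₂ _+_ (∑-𝟙-≡ k t) (∑-𝟙-≡ k (k ∸ t)) ⟩
  𝟙 (t <ᵇ k) + 𝟙 (k ∸ t <ᵇ k) ∎
  where open ≡-Reasoning

sphereSize-0 : ∀ {k} → 0 < k → sphereSize k 0 ≡ 1
sphereSize-0 {k} 0<k =
  trans (sphereSize≡ 0<k) (cong₂ (λ x y → 𝟙 x + 𝟙 y) (dec-true (0 <? k) 0<k) (dec-false (k <? k) (n≮n k)))

sphereSize-pos : ∀ {k t} → 0 < t → t + t < k → sphereSize k t ≡ 2
sphereSize-pos {k} {t} 0<t 2t<k =
  trans (sphereSize≡ 2t<k)
        (cong₂ (λ x y → 𝟙 x + 𝟙 y) (dec-true (t <? k) t<k)
                                   (dec-true (k ∸ t <? k) (∸-monoʳ-< 0<t (<⇒≤ t<k))))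
  where
  t<k : t < k
  t<k = ≤-<-trans (m≤m+n t t) 2t<k

∑-cycleDist-rotate : ∀ k (f : ℕ → ℕ) →
                     ∑[ a < k ] f (cycleDist k (toℕ a) 1) ≡ ∑[ b < k ] f (cycleDist k 0 (toℕ b))
∑-cycleDist-rotate zero    f = refl
∑-cycleDist-rotate (suc k) f = sym (begin
  ∑[ b < suc k ] f (wrapDist (suc k) (toℕ b))
    ≡⟨ sum-init-last {k} (λ b → f (wrapDist (suc k) (toℕ b))) ⟩
  ∑[ b < k ] f (wrapDist (suc k) (toℕ (inject₁ b))) + f (wrapDist (suc k) (toℕ (fromℕ k)))
    ≡⟨ cong₂ _+_ (sum-cong-≗ {k} (λ b → cong (f ∘ wrapDist (suc k)) (toℕ-inject₁ b))) (cong f last≡1) ⟩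
  ∑[ b < k ] f (wrapDist (suc k) (toℕ b)) + f (wrapDist (suc k) 1)
    ≡⟨ +-comm (∑[ b < k ] f (wrapDist (suc k) (toℕ b))) (f (wrapDist (suc k) 1)) ⟩
  f (wrapDist (suc k) 1) + ∑[ b < k ] f (wrapDist (suc k) (toℕ b))
    ≡⟨ cong (f (wrapDist (suc k) 1) +_)
            (sum-cong-≗ {k} (λ b → cong (f ∘ wrapDist (suc k)) (sym (∣-∣-identityʳ (toℕ b))))) ⟩
  ∑[ a < suc k ] f (cycleDist (suc k) (toℕ a) 1) ∎)
  where
  open ≡-Reasoning
  last≡1 : wrapDist (suc k) (toℕ (fromℕ k)) ≡ wrapDist (suc k) 1
  last≡1 = trans (cong (wrapDist (suc k)) (toℕ-fromℕ k)) (wrapDist-reflect (s≤s z≤n))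

crossPairs-twoApart : ∀ k → 1 < k → crossPairs k 1 ≡ 1
crossPairs-twoApart 1             (s≤s ())
crossPairs-twoApart (suc (suc k)) _        = begin
  crossPairs (2 + k) 1
    ≡⟨ sum-cong-≗ {2 + k} (λ a → sum-cong-≗ {2 + k} (λ b →
         split (cycleDist (2 + k) (toℕ a) 1) (cycleDist (2 + k) 0 (toℕ b)))) ⟩
  ∑[ a < 2 + k ] ∑[ b < 2 + k ] (A a * B b)
    ≡⟨ ∑-product (2 + k) (2 + k) A B ⟩
  (∑[ a < 2 + k ] A a) * sphereSize (2 + k) 0
    ≡⟨ cong₂ _*_ (trans (∑-cycleDist-rotate (2 + k) (λ d → 𝟙 (d ≡ᵇ 0))) N0) N0 ⟩
  1 ∎
  where
  open ≡-Reasoning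
  A B : Fin (2 + k) → ℕ
  A a = 𝟙 (cycleDist (2 + k) (toℕ a) 1 ≡ᵇ 0)
  B b = 𝟙 (cycleDist (2 + k) 0 (toℕ b) ≡ᵇ 0)
  N0 : sphereSize (2 + k) 0 ≡ 1
  N0 = sphereSize-0 {2 + k} z<s
  split : ∀ x y → 𝟙 (x + (3 + y) ≡ᵇ 3) ≡ 𝟙 (x ≡ᵇ 0) * 𝟙 (y ≡ᵇ 0)
  split zero    zero    = refl
  split zero    (suc y) = refl
  split (suc x) y       = ≢⇒𝟙≡0 (>⇒≢ (s≤s (≤-trans (m≤m+n 3 y) (m≤n+m (3 + y) x))))

crossPairs-consecutive : ∀ k → 5 ≤ k → crossPairs k 0 ≡ 8
crossPairs-consecutive k 5≤k = begin
  crossPairs k 0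
    ≡⟨ sum-cong-≗ {k} (λ a → sum-cong-≗ {k} (λ b →
         split (cycleDist k (toℕ a) 1) (cycleDist k 0 (toℕ b)))) ⟩
  ∑[ a < k ] ∑[ b < k ] (A 0 a * B 2 b + A 1 a * B 1 b + A 2 a * B 0 b)
    ≡⟨ ∑²-distrib-+ k k (λ a b → A 0 a * B 2 b + A 1 a * B 1 b) (λ a b → A 2 a * B 0 b) ⟩
  ∑[ a < k ] ∑[ b < k ] (A 0 a * B 2 b + A 1 a * B 1 b) + ∑[ a < k ] ∑[ b < k ] (A 2 a * B 0 b)
    ≡⟨ cong (_+ ∑[ a < k ] ∑[ b < k ] (A 2 a * B 0 b))
            (∑²-distrib-+ k k (λ a b → A 0 a * B 2 b) (λ a b → A 1 a * B 1 b)) ⟩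
  ∑[ a < k ] ∑[ b < k ] (A 0 a * B 2 b) + ∑[ a < k ] ∑[ b < k ] (A 1 a * B 1 b)
    + ∑[ a < k ] ∑[ b < k ] (A 2 a * B 0 b)
    ≡⟨ cong₂ _+_ (cong₂ _+_ (spheres 0 2) (spheres 1 1)) (spheres 2 0) ⟩
  sphereSize k 0 * sphereSize k 2 + sphereSize k 1 * sphereSize k 1 + sphereSize k 2 * sphereSize k 0
    ≡⟨ cong₂ _+_ (cong₂ _+_ (cong₂ _*_ N0 N2) (cong₂ _*_ N1 N1)) (cong₂ _*_ N2 N0) ⟩
  8 ∎
  where
  open ≡-Reasoning
  A B : ℕ → Fin k → ℕ
  A t a = 𝟙 (cycleDist k (toℕ a) 1 ≡ᵇ t)
  B t b = 𝟙 (cycleDist k 0 (toℕ b) ≡ᵇ t)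
  spheres : ∀ s t → ∑[ a < k ] ∑[ b < k ] (A s a * B t b) ≡ sphereSize k s * sphereSize k t
  spheres s t = trans (∑-product k k (A s) (B t))
                      (cong (_* sphereSize k t) (∑-cycleDist-rotate k (λ d → 𝟙 (d ≡ᵇ s))))
  N0 : sphereSize k 0 ≡ 1
  N0 = sphereSize-0 (≤-trans (s≤s z≤n) 5≤k)
  N1 : sphereSize k 1 ≡ 2
  N1 = sphereSize-pos (s≤s z≤n) (≤-trans (m≤m+n 3 2) 5≤k)
  N2 : sphereSize k 2 ≡ 2
  N2 = sphereSize-pos (s≤s z≤n) 5≤k
  split : ∀ x y → 𝟙 (x + suc y ≡ᵇ 3) ≡ 𝟙 (x ≡ᵇ 0) * 𝟙 (y ≡ᵇ 2) + 𝟙 (x ≡ᵇ 1) * 𝟙 (y ≡ᵇ 1)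
                                       + 𝟙 (x ≡ᵇ 2) * 𝟙 (y ≡ᵇ 0)
  split 0 0                   = refl
  split 0 1                   = refl
  split 0 2                   = refl
  split 0 (suc (suc (suc y))) = refl
  split 1 0                   = refl
  split 1 1                   = refl
  split 1 2                   = refl
  split 1 (suc (suc (suc y))) = refl
  split 2 0                   = refl
  split 2 1                   = refl
  split 2 2                   = refl
  split 2 (suc (suc (suc y))) = refl
  split (suc (suc (suc x))) y = ≢⇒𝟙≡0 (>⇒≢ (s≤s (s≤s (s≤s (≤-trans (s≤s z≤n) (m≤n+m (suc y) x))))))

Wp-orthoChain-large : ∀ h k → 7 ≤ k → Wp (orthoChain (2 + h) k) ≡ (2 + h) * k + (1 + h) * 8 + h * 1
Wp-orthoChain-large h k 7≤k =
  trans (Wp-orthoChain-closed h k 1<k)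
        (cong₂ _+_ (cong₂ _+_ (cong ((2 + h) *_) (cycleWp-large k 7≤k))
                              (cong ((1 + h) *_) (crossPairs-consecutive k (≤-trans (m≤m+n 5 2) 7≤k))))
                   (cong (h *_) (crossPairs-twoApart k 1<k)))
  where
  1<k : 1 < k
  1<k = ≤-trans (m≤m+n 2 5) 7≤k

m≡n+o⇒o≡m∸n : ∀ {m n o} → m ≡ n + o → o ≡ m ∸ n
m≡n+o⇒o≡m∸n {n = n} {o} refl = sym (m+n∸m≡n n o)

-- For k ≤ 6 the counts cycleWp k and crossPairs k j are evaluated by normalisation.
corollary2p5 : (h k : ℕ) → 2 ≤ h → 3 ≤ k →
    (k ≡ 3 → Wp (orthoChain h k) ≡ 5 * h ∸ 6)
    × (k ≡ 4 → Wp (orthoChain h k) ≡ 7 * h ∸ 8)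
    × (k ≡ 5 → Wp (orthoChain h k) ≡ 9 * h ∸ 10)
    × (k ≡ 6 → Wp (orthoChain h k) ≡ 12 * h ∸ 10)
    × (7 ≤ k → Wp (orthoChain h k) ≡ (k + 9) * h ∸ 10)
corollary2p5 _ k 2≤h 3≤k with h , refl ← m≤n⇒∃[o]m+o≡n 2≤h =
  (λ { refl → trans (Wp-orthoChain-closed h 3 1<k) (m≡n+o⇒o≡m∸n {n = 6} (k≡3 h)) }) ,
  (λ { refl → trans (Wp-orthoChain-closed h 4 1<k) (m≡n+o⇒o≡m∸n {n = 8} (k≡4 h)) }) ,
  (λ { refl → trans (Wp-orthoChain-closed h 5 1<k) (m≡n+o⇒o≡m∸n {n = 10} (k≡5 h)) }) ,
  (λ { refl → trans (Wp-orthoChain-closed h 6 1<k) (m≡n+o⇒o≡m∸n {n = 10} (k≡6 h)) }) ,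
  (λ 7≤k → trans (Wp-orthoChain-large h k 7≤k) (m≡n+o⇒o≡m∸n {n = 10} (k≥7 h k)))
  where
  1<k : 1 < k
  1<k = ≤-trans (s≤s (s≤s z≤n)) 3≤k
  k≡3 : ∀ h → 5 * (2 + h) ≡ 6 + ((2 + h) * 0 + (1 + h) * 4 + h * 1)
  k≡3 = solve-∀
  k≡4 : ∀ h → 7 * (2 + h) ≡ 8 + ((2 + h) * 0 + (1 + h) * 6 + h * 1)
  k≡4 = solve-∀
  k≡5 : ∀ h → 9 * (2 + h) ≡ 10 + ((2 + h) * 0 + (1 + h) * 8 + h * 1)
  k≡5 = solve-∀
  k≡6 : ∀ h → 12 * (2 + h) ≡ 10 + ((2 + h) * 3 + (1 + h) * 8 + h * 1)
  k≡6 = solve-∀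
  k≥7 : ∀ h k → (k + 9) * (2 + h) ≡ 10 + ((2 + h) * k + (1 + h) * 8 + h * 1)
  k≥7 = solve-∀
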